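{- Let $p$ be a prime, $P(t)\in\mathbb{Z}_p[t]$ a monic polynomial, $G$ a finite $\mathbb{Z}_p[t]/(P(t))$-module, and $k\in\mathbb{Z}_{\ge1}$ with $p^{k-1}G=0$. For $X\in\mathrm{M}_n(\mathbb{Z}_p)$ let $X'\in\mathrm{M}_n(\mathbb{Z}/p^k\mathbb{Z})$ be its reduction modulo $p^k$. Then $\mathrm{cok}(P(X))\simeq_{\mathbb{Z}_p[t]}G$ if and only if $\mathrm{cok}(P(X'))\simeq_{(\mathbb{Z}/p^k\mathbb{Z})[t]}G$.
   Context: $\mathrm{cok}(P(X))=\mathbb{Z}_p^n/P(X)\mathbb{Z}_p^n$ is a $\mathbb{Z}_p[t]$-module with $t$ acting by $X$; similarly $\mathrm{cok}(P(X'))=(\mathbb{Z}/p^k\mathbb{Z})^n/P(X')(\mathbb{Z}/p^k\mathbb{Z})^n$ is a $(\mathbb{Z}/p^k\mathbb{Z})[t]$-module with $t$ acting by $X'$. -}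

module Defs where

open import Data.Nat as ℕ using (ℕ; zero; suc; _^_)
open import Data.Integer as ℤ using (ℤ; +_; _+_; _*_; _-_)
open import Data.Integer.Divisibility using (_∣_)
open import Data.Fin using (Fin; zero; suc)
open import Data.List using (List; []; _∷_; map)
open import Data.List.Relation.Unary.All using (All)
open import Data.Product using (Σ; _×_; ∃)
open import Function.Bundles using (_↔_)
open import Relation.Binary.PropositionalEquality using (_≡_)
open import Algebra.Structures using (IsAbelianGroup)

-- p-adic integers ℤ_p as the inverse limit lim ℤ/p^k.
-- A raw p-adic number is a sequence x with x k ∈ ℤ a representative
-- of its residue modulo p^k.  It is a genuine element of ℤ_p when
-- the sequence is coherent; two are equal when they agree mod p^k
-- at every level k.

RawZp : Set
RawZp = ℕ → ℤ

pk : ℕ → ℕ → ℤ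
pk p k = + (p ^ k)

_≡[mod_]_ : ℤ → ℤ → ℤ → Set
a ≡[mod m ] b = m ∣ (a - b)

Coherent : ℕ → RawZp → Set
Coherent p x = ∀ k → x (suc k) ≡[mod pk p k ] x k

_≈[_]_ : RawZp → ℕ → RawZp → Set
x ≈[ p ] y = ∀ k → x k ≡[mod pk p k ] y k

_+ₚ_ : RawZp → RawZp → RawZp
(x +ₚ y) k = x k + y k

_*ₚ_ : RawZp → RawZp → RawZp
(x *ₚ y) k = x k * y k

ι : ℤ → RawZp
ι a _ = a

sumFin : ∀ n → (Fin n → ℤ) → ℤ
sumFin zero f = + 0
sumFin (suc n) f = f zero + sumFin n (λ i → f (suc i))

Vecℤ : ℕ → Set
Vecℤ n = Fin n → ℤ

Matℤ : ℕ → Set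
Matℤ n = Fin n → Fin n → ℤ

matVec : ∀ {n} → Matℤ n → Vecℤ n → Vecℤ n
matVec {n} M v i = sumFin n (λ j → M i j * v j)

addV : ∀ {n} → Vecℤ n → Vecℤ n → Vecℤ n
addV v w i = v i + w i

scalV : ∀ {n} → ℤ → Vecℤ n → Vecℤ n
scalV a v i = a * v i

-- A monic polynomial P(t) = t^d + c_{d-1} t^{d-1} + ... + c_0 is given
-- by the list of its lower coefficients cs = [c_0, ..., c_{d-1}].
-- monicApply cs M v = P(M) v   (Horner scheme)
monicApply : ∀ {n} → List ℤ → Matℤ n → Vecℤ n → Vecℤ n
monicApply [] M v = v
monicApply (c ∷ cs) M v = addV (scalV c v) (matVec M (monicApply cs M v))

VecEqMod : ∀ {n} → ℤ → Vecℤ n → Vecℤ n → Set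
VecEqMod m v w = ∀ i → v i ≡[mod m ] w i

VecZp : ℕ → Set
VecZp n = Fin n → RawZp

MatZp : ℕ → Set
MatZp n = Fin n → Fin n → RawZp

CohVec : ℕ → ∀ {n} → VecZp n → Set
CohVec p v = ∀ i → Coherent p (v i)

CohMat : ℕ → ∀ {n} → MatZp n → Set
CohMat p X = ∀ i j → Coherent p (X i j)

atV : ∀ {n} → VecZp n → ℕ → Vecℤ n
atV v k i = v i k

-- reduction X' of X modulo p^k (a representative at level k)
atM : ∀ {n} → MatZp n → ℕ → Matℤ n
atM X k i j = X i j k

atP : List RawZp → ℕ → List ℤ
atP cs k = map (λ c → c k) cs

_≈V[_]_ : ∀ {n} → VecZp n → ℕ → VecZp n → Set
v ≈V[ p ] w = ∀ k → VecEqMod (pk p k) (atV v k) (atV w k)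

-- v ≡ w in cok(P(X)) = ℤ_p^n / P(X) ℤ_p^n
CokRelZp : ℕ → List RawZp → ∀ {n} → MatZp n → VecZp n → VecZp n → Set
CokRelZp p cs {n} X v w =
  Σ (VecZp n) λ u → CohVec p u ×
    (∀ k → VecEqMod (pk p k) (atV v k)
                    (addV (atV w k) (monicApply (atP cs k) (atM X k) (atV u k))))

-- v ≡ w in cok(P(X')) = (ℤ/p^k)^n / P(X') (ℤ/p^k)^n
CokRelMod : ℕ → ℕ → List RawZp → ∀ {n} → MatZp n → Vecℤ n → Vecℤ n → Set
CokRelMod p k cs {n} X v w =
  Σ (Vecℤ n) λ u →
    VecEqMod (pk p k) v (addV w (monicApply (atP cs k) (atM X k) u))

hornerAct : {C : Set} → (C → C → C) → (RawZp → C → C) → (C → C) →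
            List RawZp → C → C
hornerAct _⊕_ _·_ T [] g = g
hornerAct _⊕_ _·_ T (c ∷ cs) g = (c · g) ⊕ T (hornerAct _⊕_ _·_ T cs g)

record FinModule (p : ℕ) (cs : List RawZp) : Set₁ where
  field
    Carrier : Set
    _⊕_ : Carrier → Carrier → Carrier
    𝟘 : Carrier
    ⊖_ : Carrier → Carrier
    isAbelianGroup : IsAbelianGroup _≡_ _⊕_ 𝟘 ⊖_
    finite : Σ ℕ λ m → Carrier ↔ Fin m
    _·_ : RawZp → Carrier → Carrier
    ·-cong : ∀ a b g → Coherent p a → Coherent p b → a ≈[ p ] b → a · g ≡ b · g
    ·-distribˡ : ∀ a g h → Coherent p a → a · (g ⊕ h) ≡ (a · g) ⊕ (a · h)
    ·-distribʳ : ∀ a b g → Coherent p a → Coherent p b → (a +ₚ b) · g ≡ (a · g) ⊕ (b · g)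
    ·-assoc : ∀ a b g → Coherent p a → Coherent p b → (a *ₚ b) · g ≡ a · (b · g)
    ·-identity : ∀ g → ι (+ 1) · g ≡ g
    T : Carrier → Carrier
    T-additive : ∀ g h → T (g ⊕ h) ≡ T g ⊕ T h
    T-linear : ∀ a g → Coherent p a → T (a · g) ≡ a · T g
    -- P(T) = 0, i.e. the ℤ_p[t]-action factors through ℤ_p[t]/(P(t))
    P-kills : ∀ g → hornerAct _⊕_ _·_ T cs g ≡ 𝟘

module _ {p : ℕ} {cs : List RawZp} (G : FinModule p cs) where
  open FinModule G

  -- f : ℤ_p^n → G induces an isomorphism cok(P(X)) ≅ G of ℤ_p[t]-modules
  record IsCokIsoZp {n} (X : MatZp n) (f : VecZp n → Carrier) : Set where
    field
      wd : ∀ v w → CohVec p v → CohVec p w → CokRelZp p cs X v w → f v ≡ f w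
      additive : ∀ v w u → CohVec p v → CohVec p w → CohVec p u →
                 u ≈V[ p ] (λ i → v i +ₚ w i) → f u ≡ f v ⊕ f w
      scalar : ∀ a v u → Coherent p a → CohVec p v → CohVec p u →
               u ≈V[ p ] (λ i → a *ₚ v i) → f u ≡ a · f v
      t-equiv : ∀ v u → CohVec p v → CohVec p u →
                (∀ k → VecEqMod (pk p k) (atV u k) (matVec (atM X k) (atV v k))) →
                f u ≡ T (f v)
      injective : ∀ v w → CohVec p v → CohVec p w → f v ≡ f w → CokRelZp p cs X v w
      surjective : ∀ g → Σ (VecZp n) λ v → CohVec p v × (f v ≡ g)

  CokIsoZp : ∀ {n} → MatZp n → Set
  CokIsoZp {n} X = Σ (VecZp n → Carrier) (IsCokIsoZp X)

  -- f : (ℤ/p^k)^n → G induces an isomorphism cok(P(X')) ≅ G of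
  -- (ℤ/p^k)[t]-modules (G being a ℤ/p^k-module as p^k G = 0)
  record IsCokIsoMod (k : ℕ) {n} (X : MatZp n) (f : Vecℤ n → Carrier) : Set where
    field
      wd : ∀ v w → CokRelMod p k cs X v w → f v ≡ f w
      additive : ∀ v w → f (addV v w) ≡ f v ⊕ f w
      scalar : ∀ a v → f (scalV a v) ≡ ι a · f v
      t-equiv : ∀ v → f (matVec (atM X k) v) ≡ T (f v)
      injective : ∀ v w → f v ≡ f w → CokRelMod p k cs X v w
      surjective : ∀ g → Σ (Vecℤ n) λ v → f v ≡ g

  CokIsoMod : ℕ → ∀ {n} → MatZp n → Set
  CokIsoMod k {n} X = Σ (Vecℤ n → Carrier) (IsCokIsoMod k X)

  AnnihilatedBy : ℕ → Set
  AnnihilatedBy e = ∀ g → ι (+ (p ^ e)) · g ≡ 𝟘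

-- Write k = k′ + 1.  An isomorphism f : cok P(X) ≅ G induces one on cok P(X′) by restricting f
-- to constant lifts, and an isomorphism f′ : cok P(X′) ≅ G induces one on cok P(X) by composing
-- with reduction mod p^k.  Both are well defined because p^k G = 0, so f only sees its argument
-- modulo p^k.  The one real point is injectivity of the second map: a relation v ≡ w + P(X′) u₀
-- (mod p^k) has to be lifted to ℤ_p.  Since p^k′ G = 0 and f′ is injective, every p^k′ z equals
-- P(X′) u modulo p^k, i.e. p^k′ z = P(X) u + p^k′ (p z₁) with z₁ coherent.  Iterating and summing
-- the p-adically convergent series Σ p^N u_N shows p^k′ ℤ_p^n ⊆ P(X) ℤ_p^n, and this absorbs the
-- error v − w − P(X) u₀ = p^k e = p^k′ (p e).

module Submission where

open import Defs
open import Algebra.Bundles using (Group)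
import Algebra.Properties.Group as GroupProperties
open import Algebra.Structures using (IsAbelianGroup)
open import Data.Fin using (Fin; zero; suc)
open import Data.Integer as ℤ using (ℤ; +_; 0ℤ; _+_; _*_; _-_; -_)
import Data.Integer.Divisibility.Signed as Signed
import Data.Integer.Properties as ℤₚ
open import Algebra.Properties.CommutativeSemigroup ℤₚ.+-commutativeSemigroup using (interchange)
open import Algebra.Properties.CommutativeSemigroup ℤₚ.*-commutativeSemigroup using (x∙yz≈y∙xz)
open import Data.Integer.Tactic.RingSolver using (solve-∀)
open import Data.List using (List; []; _∷_)
open import Data.List.Relation.Binary.Pointwise using (Pointwise; []; _∷_)
open import Data.List.Relation.Unary.All using (All; []; _∷_)
open import Data.Nat as ℕ using (ℕ; zero; suc; _≤_; _∸_; _≤′_; ≤′-refl; ≤′-step)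
import Data.Nat.Properties as ℕₚ
open import Data.Nat.Primality using (Prime; prime⇒nonZero)
open import Data.Product using (Σ; _×_; _,_; proj₁; proj₂)
open import Relation.Binary.Bundles using (Setoid)
open import Relation.Binary.PropositionalEquality
import Relation.Binary.Reasoning.Setoid as SetoidReasoning

infix 4 _≡_[mod_] _≡ᵛ_[mod_]

-- A record, unlike the unsigned _≡[mod_]_ of Defs, lets Agda infer a, b and m from a proof.
record _≡_[mod_] (a b m : ℤ) : Set where
  constructor mkMod
  field divides : m Signed.∣ a - b

open _≡_[mod_]

_≡ᵛ_[mod_] : ∀ {n} → Vecℤ n → Vecℤ n → ℤ → Set
u ≡ᵛ v [mod m ] = ∀ i → u i ≡ v i [mod m ]

variable
  a b c d m m′ : ℤ
  n : ℕ

fromUnsigned : a ≡[mod m ] b → a ≡ b [mod m ]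
fromUnsigned h = mkMod (Signed.∣ᵤ⇒∣ h)

toUnsigned : ∀ m → a ≡ b [mod m ] → a ≡[mod m ] b
toUnsigned m h = Signed.∣⇒∣ᵤ (divides h)

≡-mod-via : m Signed.∣ c → a - b ≡ c → a ≡ b [mod m ]
≡-mod-via m∣c refl = mkMod m∣c

≡-mod-reflexive : a ≡ b → a ≡ b [mod m ]
≡-mod-reflexive {a} {m = m} refl = ≡-mod-via (Signed.divides 0ℤ (sym (ℤₚ.*-zeroˡ m))) (ℤₚ.+-inverseʳ a)

≡-mod-refl : a ≡ a [mod m ]
≡-mod-refl = ≡-mod-reflexive refl

≡-mod-sym : a ≡ b [mod m ] → b ≡ a [mod m ]
≡-mod-sym {a} {b} (mkMod m∣a-b) = ≡-mod-via (Signed.∣m⇒∣-m m∣a-b) (identity a b)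
  where identity : ∀ a b → b - a ≡ - (a - b)
        identity = solve-∀

≡-mod-trans : a ≡ b [mod m ] → b ≡ c [mod m ] → a ≡ c [mod m ]
≡-mod-trans {a} {b} {c = c} (mkMod m∣a-b) (mkMod m∣b-c) =
  ≡-mod-via (Signed.∣m∣n⇒∣m+n m∣a-b m∣b-c) (identity a b c)
  where identity : ∀ a b c → a - c ≡ (a - b) + (b - c)
        identity = solve-∀

≡-mod-setoid : ℤ → Setoid _ _
≡-mod-setoid m = record
  { Carrier = ℤ
  ; _≈_ = λ a b → a ≡ b [mod m ]
  ; isEquivalence = record { refl = ≡-mod-refl ; sym = ≡-mod-sym ; trans = ≡-mod-trans }
  }

+-cong-mod : a ≡ b [mod m ] → c ≡ d [mod m ] → a + c ≡ b + d [mod m ]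
+-cong-mod {a} {b} {c = c} {d} (mkMod m∣a-b) (mkMod m∣c-d) =
  ≡-mod-via (Signed.∣m∣n⇒∣m+n m∣a-b m∣c-d) (identity a b c d)
  where identity : ∀ a b c d → (a + c) - (b + d) ≡ (a - b) + (c - d)
        identity = solve-∀

*-cong-mod : a ≡ b [mod m ] → c ≡ d [mod m ] → a * c ≡ b * d [mod m ]
*-cong-mod {a} {b} {c = c} {d} (mkMod m∣a-b) (mkMod m∣c-d) =
  ≡-mod-via (Signed.∣m∣n⇒∣m+n (Signed.∣n⇒∣m*n a m∣c-d) (Signed.∣m⇒∣m*n d m∣a-b)) (identity a b c d)
  where identity : ∀ a b c d → (a * c) - (b * d) ≡ a * (c - d) + (a - b) * d
        identity = solve-∀

+-congˡ-mod : ∀ a → c ≡ d [mod m ] → a + c ≡ a + d [mod m ]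
+-congˡ-mod a = +-cong-mod (≡-mod-refl {a})

*-congˡ-mod : ∀ a → c ≡ d [mod m ] → a * c ≡ a * d [mod m ]
*-congˡ-mod a = *-cong-mod (≡-mod-refl {a})

neg-cong-mod : a ≡ b [mod m ] → - a ≡ - b [mod m ]
neg-cong-mod {a} {b} (mkMod m∣a-b) = ≡-mod-via (Signed.∣m⇒∣-m m∣a-b) (identity a b)
  where identity : ∀ a b → (- a) - (- b) ≡ - (a - b)
        identity = solve-∀

-cong-mod : a ≡ b [mod m ] → c ≡ d [mod m ] → a - c ≡ b - d [mod m ]
-cong-mod a≡b c≡d = +-cong-mod a≡b (neg-cong-mod c≡d)

∣-weaken-mod : m′ Signed.∣ m → a ≡ b [mod m ] → a ≡ b [mod m′ ]
∣-weaken-mod m′∣m (mkMod m∣a-b) = mkMod (Signed.∣-trans m′∣m m∣a-b)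

m*n≡0-mod : ∀ m c → m * c ≡ 0ℤ [mod m ]
m*n≡0-mod m c = ≡-mod-via (Signed.divides c refl) (identity m c)
  where identity : ∀ m c → (m * c) - 0ℤ ≡ c * m
        identity = solve-∀

≡-mod⇒-≡0 : a ≡ b [mod m ] → a - b ≡ 0ℤ [mod m ]
≡-mod⇒-≡0 {a} {b} (mkMod m∣a-b) = ≡-mod-via m∣a-b (ℤₚ.+-identityʳ (a - b))

-≡⇒≡+-mod : a - b ≡ c [mod m ] → a ≡ b + c [mod m ]
-≡⇒≡+-mod {a} {b} {c} (mkMod m∣a-b-c) = ≡-mod-via m∣a-b-c (identity a b c)
  where identity : ∀ a b c → a - (b + c) ≡ (a - b) - c
        identity = solve-∀

sumFin-cong : ∀ n {f g : Fin n → ℤ} → f ≗ g → sumFin n f ≡ sumFin n g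
sumFin-cong zero    f≗g = refl
sumFin-cong (suc n) f≗g = cong₂ _+_ (f≗g zero) (sumFin-cong n (λ i → f≗g (suc i)))

sumFin-+ : ∀ n (f g : Fin n → ℤ) → sumFin n (λ i → f i + g i) ≡ sumFin n f + sumFin n g
sumFin-+ zero    f g = refl
sumFin-+ (suc n) f g = begin
  (f zero + g zero) + sumFin n (λ i → f (suc i) + g (suc i))
    ≡⟨ cong (_+_ (f zero + g zero)) (sumFin-+ n (λ i → f (suc i)) (λ i → g (suc i))) ⟩
  (f zero + g zero) + (sumFin n (λ i → f (suc i)) + sumFin n (λ i → g (suc i)))
    ≡⟨ interchange (f zero) (g zero) _ _ ⟩
  (f zero + sumFin n (λ i → f (suc i))) + (g zero + sumFin n (λ i → g (suc i))) ∎
  where open ≡-Reasoning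

sumFin-* : ∀ n a (f : Fin n → ℤ) → sumFin n (λ i → a * f i) ≡ a * sumFin n f
sumFin-* zero    a f = sym (ℤₚ.*-zeroʳ a)
sumFin-* (suc n) a f = begin
  a * f zero + sumFin n (λ i → a * f (suc i)) ≡⟨ cong (_+_ (a * f zero)) (sumFin-* n a (λ i → f (suc i))) ⟩
  a * f zero + a * sumFin n (λ i → f (suc i)) ≡⟨ ℤₚ.*-distribˡ-+ a (f zero) _ ⟨
  a * (f zero + sumFin n (λ i → f (suc i)))   ∎
  where open ≡-Reasoning

sumFin-cong-mod : ∀ n {f g : Fin n → ℤ} → f ≡ᵛ g [mod m ] → sumFin n f ≡ sumFin n g [mod m ]
sumFin-cong-mod zero    f≡g = ≡-mod-refl
sumFin-cong-mod (suc n) f≡g = +-cong-mod (f≡g zero) (sumFin-cong-mod n (λ i → f≡g (suc i)))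

matVec-cong : (M : Matℤ n) {u v : Vecℤ n} → u ≗ v → matVec M u ≗ matVec M v
matVec-cong M u≗v i = sumFin-cong _ (λ j → cong (M i j *_) (u≗v j))

matVec-+ : (M : Matℤ n) (u v : Vecℤ n) → matVec M (addV u v) ≗ addV (matVec M u) (matVec M v)
matVec-+ {n} M u v i = trans (sumFin-cong n (λ j → ℤₚ.*-distribˡ-+ (M i j) (u j) (v j))) (sumFin-+ n _ _)

matVec-* : (M : Matℤ n) (a : ℤ) (u : Vecℤ n) → matVec M (scalV a u) ≗ scalV a (matVec M u)
matVec-* {n} M a u i = trans (sumFin-cong n (λ j → x∙yz≈y∙xz (M i j) a (u j))) (sumFin-* n a _)

matVec-cong-mod : {M M′ : Matℤ n} {u v : Vecℤ n} → (∀ i → M i ≡ᵛ M′ i [mod m ]) →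
                  u ≡ᵛ v [mod m ] → matVec M u ≡ᵛ matVec M′ v [mod m ]
matVec-cong-mod M≡M′ u≡v i = sumFin-cong-mod _ (λ j → *-cong-mod (M≡M′ i j) (u≡v j))

monicApply-cong : ∀ cs (M : Matℤ n) {u v : Vecℤ n} → u ≗ v → monicApply cs M u ≗ monicApply cs M v
monicApply-cong []       M u≗v = u≗v
monicApply-cong (c ∷ cs) M u≗v i =
  cong₂ _+_ (cong (c *_) (u≗v i)) (matVec-cong M (monicApply-cong cs M u≗v) i)

monicApply-+ : ∀ cs (M : Matℤ n) (u v : Vecℤ n) →
               monicApply cs M (addV u v) ≗ addV (monicApply cs M u) (monicApply cs M v)
monicApply-+ []       M u v i = refl
monicApply-+ (c ∷ cs) M u v i = begin
  c * (u i + v i) + matVec M (monicApply cs M (addV u v)) i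
    ≡⟨ cong (_+_ (c * (u i + v i))) (trans (matVec-cong M (monicApply-+ cs M u v) i) (matVec-+ M _ _ i)) ⟩
  c * (u i + v i) + (matVec M (monicApply cs M u) i + matVec M (monicApply cs M v) i)
    ≡⟨ cong (_+ _) (ℤₚ.*-distribˡ-+ c (u i) (v i)) ⟩
  (c * u i + c * v i) + (matVec M (monicApply cs M u) i + matVec M (monicApply cs M v) i)
    ≡⟨ interchange (c * u i) (c * v i) _ _ ⟩
  (c * u i + matVec M (monicApply cs M u) i) + (c * v i + matVec M (monicApply cs M v) i) ∎
  where open ≡-Reasoning

monicApply-* : ∀ cs (M : Matℤ n) a (u : Vecℤ n) →
               monicApply cs M (scalV a u) ≗ scalV a (monicApply cs M u)
monicApply-* []       M a u i = refl
monicApply-* (c ∷ cs) M a u i = begin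
  c * (a * u i) + matVec M (monicApply cs M (scalV a u)) i
    ≡⟨ cong (_+_ (c * (a * u i))) (trans (matVec-cong M (monicApply-* cs M a u) i) (matVec-* M a _ i)) ⟩
  c * (a * u i) + a * matVec M (monicApply cs M u) i
    ≡⟨ cong (_+ _) (x∙yz≈y∙xz c a (u i)) ⟩
  a * (c * u i) + a * matVec M (monicApply cs M u) i
    ≡⟨ ℤₚ.*-distribˡ-+ a (c * u i) _ ⟨
  a * (c * u i + matVec M (monicApply cs M u) i) ∎
  where open ≡-Reasoning

monicApply-0 : ∀ cs (M : Matℤ n) → monicApply cs M (λ _ → 0ℤ) ≗ (λ _ → 0ℤ)
monicApply-0 cs M = monicApply-* cs M 0ℤ (λ _ → 0ℤ)

monicApply-cong-mod : ∀ {cs ds} {M M′ : Matℤ n} {u v : Vecℤ n} →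
                      Pointwise (λ c d → c ≡ d [mod m ]) cs ds → (∀ i → M i ≡ᵛ M′ i [mod m ]) →
                      u ≡ᵛ v [mod m ] → monicApply cs M u ≡ᵛ monicApply ds M′ v [mod m ]
monicApply-cong-mod []           M≡M′ u≡v = u≡v
monicApply-cong-mod (c≡d ∷ cs≡ds) M≡M′ u≡v i =
  +-cong-mod (*-cong-mod c≡d (u≡v i)) (matVec-cong-mod M≡M′ (monicApply-cong-mod cs≡ds M≡M′ u≡v) i)

pk-suc : ∀ p k → pk p (suc k) ≡ + p * pk p k
pk-suc p k = ℤₚ.pos-* p (p ℕ.^ k)

pk-+ : ∀ p j k → pk p (j ℕ.+ k) ≡ pk p j * pk p k
pk-+ p j k = trans (cong +_ (ℕₚ.^-distribˡ-+-* p j k)) (ℤₚ.pos-* (p ℕ.^ j) (p ℕ.^ k))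

pk-∣ : ∀ p {j l} → j ≤′ l → pk p j Signed.∣ pk p l
pk-∣ p ≤′-refl                  = Signed.∣-refl
pk-∣ p {l = suc l} (≤′-step j≤′l) =
  subst (_ Signed.∣_) (sym (pk-suc p l)) (Signed.∣n⇒∣m*n (+ p) (pk-∣ p j≤′l))

infix 4 _≡ₚ_[mod_^_]

_≡ₚ_[mod_^_] : RawZp → RawZp → ℕ → ℕ → Set
x ≡ₚ y [mod p ^ k ] = Σ RawZp λ e → Coherent p e × (∀ j → x j ≡ y j + pk p k * e j [mod pk p j ])

module _ {p : ℕ} where

  coherent : (x : RawZp) → (∀ j → x (suc j) ≡ x j [mod pk p j ]) → Coherent p x
  coherent x step j = toUnsigned (pk p j) (step j)

  coherent⁻¹ : (x : RawZp) → Coherent p x → ∀ j → x (suc j) ≡ x j [mod pk p j ]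
  coherent⁻¹ x cx j = fromUnsigned (cx j)

  ι-coherent : ∀ a → Coherent p (ι a)
  ι-coherent a = coherent (ι a) (λ _ → ≡-mod-refl)

  +ₚ-coherent : ∀ x y → Coherent p x → Coherent p y → Coherent p (x +ₚ y)
  +ₚ-coherent x y cx cy = coherent (x +ₚ y) (λ j → +-cong-mod (coherent⁻¹ x cx j) (coherent⁻¹ y cy j))

  *ₚ-coherent : ∀ x y → Coherent p x → Coherent p y → Coherent p (x *ₚ y)
  *ₚ-coherent x y cx cy = coherent (x *ₚ y) (λ j → *-cong-mod (coherent⁻¹ x cx j) (coherent⁻¹ y cy j))

  -ₚ-coherent : ∀ x y → Coherent p x → Coherent p y → Coherent p (λ j → x j - y j)
  -ₚ-coherent x y cx cy = coherent _ (λ j → -cong-mod (coherent⁻¹ x cx j) (coherent⁻¹ y cy j))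

  coherent-≤′ : ∀ x {j l} → Coherent p x → j ≤′ l → x l ≡ x j [mod pk p j ]
  coherent-≤′ x cx ≤′-refl = ≡-mod-refl
  coherent-≤′ x {l = suc l} cx (≤′-step j≤′l) =
    ≡-mod-trans (∣-weaken-mod (pk-∣ p j≤′l) (coherent⁻¹ x cx l)) (coherent-≤′ x cx j≤′l)

  coherent-≤ : ∀ x {j l} → Coherent p x → j ≤ l → x l ≡ x j [mod pk p j ]
  coherent-≤ x cx j≤l = coherent-≤′ x cx (ℕₚ.≤⇒≤′ j≤l)

  ≗⇒≈ : (x y : RawZp) → x ≗ y → x ≈[ p ] y
  ≗⇒≈ x y x≗y j = toUnsigned (pk p j) (≡-mod-reflexive (x≗y j))

  ≈V-refl : ∀ {n} (v : VecZp n) → v ≈V[ p ] v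
  ≈V-refl v j i = toUnsigned (pk p j) (≡-mod-refl {v i j})

  atP-≤ : ∀ {cs j l} → All (Coherent p) cs → j ≤ l →
          Pointwise (λ c d → c ≡ d [mod pk p j ]) (atP cs l) (atP cs j)
  atP-≤ []                   j≤l = []
  atP-≤ {c ∷ _} (cc ∷ cs-coh) j≤l = coherent-≤ c cc j≤l ∷ atP-≤ cs-coh j≤l

module _ {p : ℕ} {{_ : ℕ.NonZero p}} where

  -- The quotient e is read off levelwise: e j := (x − y)(j + k) / p^k.
  ≡-at-level⇒≡ₚ : ∀ k x y → Coherent p x → Coherent p y →
                  x k ≡ y k [mod pk p k ] → x ≡ₚ y [mod p ^ k ]
  ≡-at-level⇒≡ₚ k x y cx cy xₖ≡yₖ = e , e-coherent , λ j → -≡⇒≡+-mod (split j)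
    where
      δ : RawZp
      δ j = x j - y j
      δ-coherent : Coherent p δ
      δ-coherent = -ₚ-coherent x y cx cy
      pk∣δ : ∀ j → δ (j ℕ.+ k) ≡ 0ℤ [mod pk p k ]
      pk∣δ j = ≡-mod-trans (coherent-≤ δ δ-coherent (ℕₚ.m≤n+m k j)) (≡-mod⇒-≡0 xₖ≡yₖ)
      e : RawZp
      e j = Signed.quotient (divides (pk∣δ j))
      δ≡pk*e : ∀ j → δ (j ℕ.+ k) ≡ pk p k * e j
      δ≡pk*e j = trans (sym (ℤₚ.+-identityʳ _))
                       (trans (Signed._∣_.equality (divides (pk∣δ j))) (ℤₚ.*-comm (e j) (pk p k)))
      instance
        pk≢0 : ℤ.NonZero (pk p k)
        pk≢0 = ℕₚ.m^n≢0 p k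
      e-coherent : Coherent p e
      e-coherent = coherent e λ j → mkMod (Signed.*-cancelʳ-∣ (pk p k) (subst₂ Signed._∣_ (pk-+ p j k)
        (begin
          δ (suc j ℕ.+ k) - δ (j ℕ.+ k)       ≡⟨ cong₂ _-_ (δ≡pk*e (suc j)) (δ≡pk*e j) ⟩
          pk p k * e (suc j) - pk p k * e j   ≡⟨ factor (pk p k) (e (suc j)) (e j) ⟩
          (e (suc j) - e j) * pk p k          ∎)
        (divides (coherent⁻¹ δ δ-coherent (j ℕ.+ k)))))
        where open ≡-Reasoning
              factor : ∀ q a b → q * a - q * b ≡ (a - b) * q
              factor = solve-∀
      split : ∀ j → δ j ≡ pk p k * e j [mod pk p j ]
      split j = ≡-mod-trans (≡-mod-sym (coherent-≤ δ δ-coherent (ℕₚ.m≤m+n j k)))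
                            (≡-mod-reflexive (δ≡pk*e j))

module _ {p : ℕ} {cs : List RawZp} (G : FinModule p cs) where
  open FinModule G

  x≡x⊕x⇒x≡𝟘 : ∀ g → g ≡ g ⊕ g → g ≡ 𝟘
  x≡x⊕x⇒x≡𝟘 g g≡g⊕g = GroupProperties.identityˡ-unique group g g (sym g≡g⊕g)
    where group : Group _ _
          group = record { isGroup = IsAbelianGroup.isGroup isAbelianGroup }

  annihilatedBy-suc : ∀ e → AnnihilatedBy G e → AnnihilatedBy G (suc e)
  annihilatedBy-suc e ann g = begin
    ι (pk p (suc e)) · g
      ≡⟨ ·-cong _ _ g (ι-coherent (pk p (suc e))) pₑ*p-coherent
                (≗⇒≈ (ι (pk p (suc e))) (ι (pk p e) *ₚ ι (+ p)) λ _ → pₑ₊₁≡pₑ*p) ⟩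
    (ι (pk p e) *ₚ ι (+ p)) · g
      ≡⟨ ·-assoc _ _ g (ι-coherent (pk p e)) (ι-coherent (+ p)) ⟩
    ι (pk p e) · (ι (+ p) · g)
      ≡⟨ ann (ι (+ p) · g) ⟩
    𝟘 ∎
    where
      open ≡-Reasoning
      pₑ*p-coherent : Coherent p (ι (pk p e) *ₚ ι (+ p))
      pₑ*p-coherent = *ₚ-coherent (ι (pk p e)) (ι (+ p)) (ι-coherent (pk p e)) (ι-coherent (+ p))
      pₑ₊₁≡pₑ*p : pk p (suc e) ≡ pk p e * + p
      pₑ₊₁≡pₑ*p = trans (pk-suc p e) (ℤₚ.*-comm (+ p) (pk p e))

  ·-reduce : {{_ : ℕ.NonZero p}} → ∀ k → AnnihilatedBy G k →
             ∀ a → Coherent p a → ∀ g → a · g ≡ ι (a k) · g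
  ·-reduce k ann a ca g = begin
    a · g
      ≡⟨ ·-cong a (ι (a k) +ₚ pᵏe) g ca aₖ+pᵏe-coherent (λ j → toUnsigned (pk p j) (a≡aₖ+pᵏe j)) ⟩
    (ι (a k) +ₚ pᵏe) · g
      ≡⟨ ·-distribʳ (ι (a k)) pᵏe g (ι-coherent (a k)) pᵏe-coherent ⟩
    (ι (a k) · g) ⊕ (pᵏe · g)
      ≡⟨ cong ((ι (a k) · g) ⊕_) (·-assoc (ι (pk p k)) e g (ι-coherent (pk p k)) ce) ⟩
    (ι (a k) · g) ⊕ (ι (pk p k) · (e · g))
      ≡⟨ cong ((ι (a k) · g) ⊕_) (ann (e · g)) ⟩
    (ι (a k) · g) ⊕ 𝟘
      ≡⟨ IsAbelianGroup.identityʳ isAbelianGroup (ι (a k) · g) ⟩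
    ι (a k) · g ∎
    where
      open ≡-Reasoning
      difference : a ≡ₚ ι (a k) [mod p ^ k ]
      difference = ≡-at-level⇒≡ₚ k a (ι (a k)) ca (ι-coherent (a k)) ≡-mod-refl
      e : RawZp
      e = proj₁ difference
      ce : Coherent p e
      ce = proj₁ (proj₂ difference)
      a≡aₖ+pᵏe : ∀ j → a j ≡ a k + pk p k * e j [mod pk p j ]
      a≡aₖ+pᵏe = proj₂ (proj₂ difference)
      pᵏe : RawZp
      pᵏe = ι (pk p k) *ₚ e
      pᵏe-coherent : Coherent p pᵏe
      pᵏe-coherent = *ₚ-coherent (ι (pk p k)) e (ι-coherent (pk p k)) ce
      aₖ+pᵏe-coherent : Coherent p (ι (a k) +ₚ pᵏe)
      aₖ+pᵏe-coherent = +ₚ-coherent (ι (a k)) pᵏe (ι-coherent (a k)) pᵏe-coherent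

module Cokernel {p : ℕ} {{_ : ℕ.NonZero p}} {cs : List RawZp} (cs-coherent : All (Coherent p) cs)
                {n : ℕ} (X : MatZp n) (X-coherent : CohMat p X) where

  P[X] : ℕ → Vecℤ n → Vecℤ n
  P[X] j = monicApply (atP cs j) (atM X j)

  X· : ℕ → Vecℤ n → Vecℤ n
  X· j = matVec (atM X j)

  atM-≤ : ∀ {j l} → j ≤ l → ∀ i → atM X l i ≡ᵛ atM X j i [mod pk p j ]
  atM-≤ j≤l i i′ = coherent-≤ (X i i′) (X-coherent i i′) j≤l

  P[X]-≤ : ∀ {j l} → j ≤ l → {u v : Vecℤ n} → u ≡ᵛ v [mod pk p j ] →
           P[X] l u ≡ᵛ P[X] j v [mod pk p j ]
  P[X]-≤ j≤l = monicApply-cong-mod (atP-≤ cs-coherent j≤l) (atM-≤ j≤l)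

  X·-≤ : ∀ {j l} → j ≤ l → {u v : Vecℤ n} → u ≡ᵛ v [mod pk p j ] →
         X· l u ≡ᵛ X· j v [mod pk p j ]
  X·-≤ j≤l = matVec-cong-mod (atM-≤ j≤l)

  const : Vecℤ n → VecZp n
  const v i = ι (v i)

  const-coherent : ∀ v → CohVec p (const v)
  const-coherent v i = ι-coherent (v i)

  P[X]ₚ : Vecℤ n → VecZp n
  P[X]ₚ u i j = P[X] j u i

  P[X]ₚ-coherent : ∀ u → CohVec p (P[X]ₚ u)
  P[X]ₚ-coherent u i = coherent (P[X]ₚ u i) (λ j → P[X]-≤ (ℕₚ.n≤1+n j) (λ _ → ≡-mod-refl) i)

  X·ₚ : Vecℤ n → VecZp n
  X·ₚ u i j = X· j u i

  X·ₚ-coherent : ∀ u → CohVec p (X·ₚ u)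
  X·ₚ-coherent u i = coherent (X·ₚ u i) (λ j → X·-≤ (ℕₚ.n≤1+n j) (λ _ → ≡-mod-refl) i)

  InImage : VecZp n → Set
  InImage y = Σ (VecZp n) λ U → CohVec p U × (∀ j → atV y j ≡ᵛ P[X] j (atV U j) [mod pk p j ])

  -- Successive approximation: if P(X) hits p^k′ ℤ_p^n modulo p^(k′+1), it hits it exactly.
  module Lifting (k′ : ℕ)
    (approx : ∀ z → Σ (Vecℤ n) λ u → scalV (pk p k′) z ≡ᵛ P[X] (suc k′) u [mod pk p (suc k′) ]) where

    CoherentVec : Set
    CoherentVec = Σ (VecZp n) (CohVec p)

    Approximates : CoherentVec → Vecℤ n → CoherentVec → Set
    Approximates (z , _) u (z′ , _) =
      ∀ j → scalV (pk p k′) (atV z j) ≡ᵛ addV (P[X] j u) (scalV (pk p (suc k′)) (atV z′ j)) [mod pk p j ]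

    approximate : ∀ z → Σ (Vecℤ n) λ u → Σ CoherentVec λ z′ → Approximates z u z′
    approximate (z , cz) = u , (e , e-coherent) , λ j i → proj₂ (proj₂ (remainder i)) j
      where
        u : Vecℤ n
        u = proj₁ (approx (atV z (suc k′)))
        remainder : ∀ i → (λ j → pk p k′ * z i j) ≡ₚ P[X]ₚ u i [mod p ^ suc k′ ]
        remainder i = ≡-at-level⇒≡ₚ (suc k′) (λ j → pk p k′ * z i j) (P[X]ₚ u i)
          (*ₚ-coherent (ι (pk p k′)) (z i) (ι-coherent (pk p k′)) (cz i)) (P[X]ₚ-coherent u i)
          (proj₂ (approx (atV z (suc k′))) i)
        e : VecZp n
        e i = proj₁ (remainder i)
        e-coherent : CohVec p e
        e-coherent i = proj₁ (proj₂ (remainder i))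

    regroup : ∀ N A B Z →
              A + pk p N * (B + pk p (suc k′) * Z) ≡ (A + pk p N * B) + pk p (suc N) * (pk p k′ * Z)
    regroup N A B Z = begin
      A + pk p N * (B + pk p (suc k′) * Z)
        ≡⟨ cong (λ t → A + pk p N * (B + t * Z)) (pk-suc p k′) ⟩
      A + pk p N * (B + (+ p * pk p k′) * Z)
        ≡⟨ identity A (pk p N) B (pk p k′) (+ p) Z ⟩
      (A + pk p N * B) + (+ p * pk p N) * (pk p k′ * Z)
        ≡⟨ cong (λ t → (A + pk p N * B) + t * (pk p k′ * Z)) (pk-suc p N) ⟨
      (A + pk p N * B) + pk p (suc N) * (pk p k′ * Z) ∎
      where
        open ≡-Reasoning
        identity : ∀ A q B r s Z → A + q * (B + (s * r) * Z) ≡ (A + q * B) + (s * q) * (r * Z)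
        identity = solve-∀

    module _ (z₀ : CoherentVec) where

      iterate : ℕ → CoherentVec
      iterate zero    = z₀
      iterate (suc N) = proj₁ (proj₂ (approximate (iterate N)))

      digit : ℕ → Vecℤ n
      digit N = proj₁ (approximate (iterate N))

      partialSum : ℕ → Vecℤ n
      partialSum zero    _ = 0ℤ
      partialSum (suc N) = addV (partialSum N) (scalV (pk p N) (digit N))

      z : ℕ → VecZp n
      z N = proj₁ (iterate N)

      invariant : ∀ N j → scalV (pk p k′) (atV (z 0) j) ≡ᵛ
                  addV (P[X] j (partialSum N)) (scalV (pk p N) (scalV (pk p k′) (atV (z N) j))) [mod pk p j ]
      invariant zero j i = ≡-mod-reflexive (sym (begin
        P[X] j (λ _ → 0ℤ) i + + 1 * (pk p k′ * z 0 i j)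
          ≡⟨ cong₂ _+_ (monicApply-0 (atP cs j) (atM X j) i) (ℤₚ.*-identityˡ (pk p k′ * z 0 i j)) ⟩
        0ℤ + pk p k′ * z 0 i j
          ≡⟨ ℤₚ.+-identityˡ (pk p k′ * z 0 i j) ⟩
        pk p k′ * z 0 i j ∎))
        where open ≡-Reasoning
      invariant (suc N) j i = begin
        pk p k′ * z 0 i j
          ≈⟨ invariant N j i ⟩
        P[X] j S i + pk p N * (pk p k′ * z N i j)
          ≈⟨ +-congˡ-mod (P[X] j S i) (*-congˡ-mod (pk p N) (proj₂ (proj₂ (approximate (iterate N))) j i)) ⟩
        P[X] j S i + pk p N * (P[X] j (digit N) i + pk p (suc k′) * z (suc N) i j)
          ≡⟨ regroup N (P[X] j S i) (P[X] j (digit N) i) (z (suc N) i j) ⟩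
        (P[X] j S i + pk p N * P[X] j (digit N) i) + pk p (suc N) * (pk p k′ * z (suc N) i j)
          ≡⟨ cong (_+ pk p (suc N) * (pk p k′ * z (suc N) i j)) P[X]-partialSum ⟨
        P[X] j (partialSum (suc N)) i + pk p (suc N) * (pk p k′ * z (suc N) i j) ∎
        where
          open SetoidReasoning (≡-mod-setoid (pk p j))
          S : Vecℤ n
          S = partialSum N
          P[X]-partialSum : P[X] j (partialSum (suc N)) i ≡ P[X] j S i + pk p N * P[X] j (digit N) i
          P[X]-partialSum = trans (monicApply-+ (atP cs j) (atM X j) S _ i)
                                  (cong (_+_ (P[X] j S i)) (monicApply-* (atP cs j) (atM X j) (pk p N) (digit N) i))

      limit : VecZp n
      limit i j = partialSum j i

      limit-coherent : CohVec p limit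
      limit-coherent i = coherent (limit i) λ j →
        ≡-mod-trans (+-congˡ-mod (partialSum j i) (m*n≡0-mod (pk p j) (digit j i)))
                    (≡-mod-reflexive (ℤₚ.+-identityʳ (partialSum j i)))

      limit-solves : ∀ j → scalV (pk p k′) (atV (z 0) j) ≡ᵛ P[X] j (atV limit j) [mod pk p j ]
      limit-solves j i = ≡-mod-trans (invariant j j i)
        (≡-mod-trans (+-congˡ-mod (P[X] j (atV limit j) i) (m*n≡0-mod (pk p j) (pk p k′ * z j i j)))
                     (≡-mod-reflexive (ℤₚ.+-identityʳ (P[X] j (atV limit j) i))))

    pk′-multiples-in-image : ∀ z → CohVec p z → InImage (λ i j → pk p k′ * z i j)
    pk′-multiples-in-image z cz = limit (z , cz) , limit-coherent (z , cz) , limit-solves (z , cz)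

module _ {p : ℕ} {{_ : ℕ.NonZero p}} {cs : List RawZp} (cs-coherent : All (Coherent p) cs)
         (G : FinModule p cs) {n : ℕ} (X : MatZp n) (X-coherent : CohMat p X) where

  open FinModule G
  open IsAbelianGroup isAbelianGroup using (identityʳ)
  open Cokernel cs-coherent X X-coherent

  0ᵥ : VecZp n
  0ᵥ = const (λ _ → 0ℤ)

  module ZpToMod (k : ℕ) (ann : AnnihilatedBy G k) (f : VecZp n → Carrier) (iso : IsCokIsoZp G X f) where
    module F = IsCokIsoZp iso

    f-0ᵥ : f 0ᵥ ≡ 𝟘
    f-0ᵥ = x≡x⊕x⇒x≡𝟘 G (f 0ᵥ) (F.additive 0ᵥ 0ᵥ 0ᵥ c0 c0 c0 (≈V-refl 0ᵥ))
      where c0 : CohVec p 0ᵥ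
            c0 = const-coherent (λ _ → 0ℤ)

    -- Two lifts agreeing modulo p^k differ by p^k times a vector, which f sends into p^k G = 0.
    f-cong-mod : ∀ z z′ → CohVec p z → CohVec p z′ → atV z k ≡ᵛ atV z′ k [mod pk p k ] → f z ≡ f z′
    f-cong-mod z z′ cz cz′ zₖ≡z′ₖ = sym (begin
      f z′
        ≡⟨ F.additive z w z′ cz w-coherent cz′ (λ j i → toUnsigned (pk p j) (proj₂ (proj₂ (difference i)) j)) ⟩
      f z ⊕ f w
        ≡⟨ cong (f z ⊕_) (F.scalar (ι (pk p k)) e w (ι-coherent (pk p k)) e-coherent w-coherent (≈V-refl w)) ⟩
      f z ⊕ (ι (pk p k) · f e)
        ≡⟨ cong (f z ⊕_) (ann (f e)) ⟩
      f z ⊕ 𝟘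
        ≡⟨ identityʳ (f z) ⟩
      f z ∎)
      where
        open ≡-Reasoning
        difference : ∀ i → z′ i ≡ₚ z i [mod p ^ k ]
        difference i = ≡-at-level⇒≡ₚ k (z′ i) (z i) (cz′ i) (cz i) (≡-mod-sym (zₖ≡z′ₖ i))
        e : VecZp n
        e i = proj₁ (difference i)
        e-coherent : CohVec p e
        e-coherent i = proj₁ (proj₂ (difference i))
        w : VecZp n
        w i = ι (pk p k) *ₚ e i
        w-coherent : CohVec p w
        w-coherent i = *ₚ-coherent (ι (pk p k)) (e i) (ι-coherent (pk p k)) (e-coherent i)

    f′ : Vecℤ n → Carrier
    f′ v = f (const v)

    f′-wd : ∀ v w → CokRelMod p k cs X v w → f′ v ≡ f′ w
    f′-wd v w (u , v≡w+Pu) = begin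
      f (const v)
        ≡⟨ f-cong-mod (const v) r (const-coherent v) r-coherent (λ i → fromUnsigned (v≡w+Pu i)) ⟩
      f r
        ≡⟨ F.additive (const w) (P[X]ₚ u) r (const-coherent w) (P[X]ₚ-coherent u) r-coherent (≈V-refl r) ⟩
      f (const w) ⊕ f (P[X]ₚ u)
        ≡⟨ cong (f (const w) ⊕_) (F.wd (P[X]ₚ u) 0ᵥ (P[X]ₚ-coherent u) (const-coherent (λ _ → 0ℤ)) P[X]u~0) ⟩
      f (const w) ⊕ f 0ᵥ
        ≡⟨ cong (f (const w) ⊕_) f-0ᵥ ⟩
      f (const w) ⊕ 𝟘
        ≡⟨ identityʳ (f (const w)) ⟩
      f (const w) ∎
      where
        open ≡-Reasoning
        r : VecZp n
        r i = const w i +ₚ P[X]ₚ u i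
        r-coherent : CohVec p r
        r-coherent i = +ₚ-coherent (const w i) (P[X]ₚ u i) (const-coherent w i) (P[X]ₚ-coherent u i)
        P[X]u~0 : CokRelZp p cs X (P[X]ₚ u) 0ᵥ
        P[X]u~0 = const u , const-coherent u ,
                  λ j i → toUnsigned (pk p j) (≡-mod-reflexive (sym (ℤₚ.+-identityˡ (P[X] j u i))))

    f′-iso : IsCokIsoMod G k X f′
    f′-iso = record
      { wd = f′-wd
      ; additive = λ v w → F.additive (const v) (const w) (const (addV v w))
          (const-coherent v) (const-coherent w) (const-coherent (addV v w)) (≈V-refl (const (addV v w)))
      ; scalar = λ a v → F.scalar (ι a) (const v) (const (scalV a v))
          (ι-coherent a) (const-coherent v) (const-coherent (scalV a v)) (≈V-refl (const (scalV a v)))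
      ; t-equiv = λ v → trans
          (f-cong-mod (const (X· k v)) (X·ₚ v) (const-coherent (X· k v)) (X·ₚ-coherent v) (λ i → ≡-mod-refl {X· k v i}))
          (F.t-equiv (const v) (X·ₚ v) (const-coherent v) (X·ₚ-coherent v) (≈V-refl (X·ₚ v)))
      ; injective = λ v w f′v≡f′w →
          case-level v w (F.injective (const v) (const w) (const-coherent v) (const-coherent w) f′v≡f′w)
      ; surjective = λ g → let (z , cz , fz≡g) = F.surjective g in
          atV z k , trans (f-cong-mod (const (atV z k)) z (const-coherent (atV z k)) cz (λ i → ≡-mod-refl {z i k})) fz≡g
      }
      where
        case-level : ∀ v w → CokRelZp p cs X (const v) (const w) → CokRelMod p k cs X v w
        case-level v w (u , _ , v≡w+Pu) = atV u k , v≡w+Pu k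

  module ModToZp (k′ : ℕ) (ann : AnnihilatedBy G k′)
                 (f′ : Vecℤ n → Carrier) (iso : IsCokIsoMod G (suc k′) X f′) where
    module F = IsCokIsoMod iso

    k : ℕ
    k = suc k′

    f′-0 : f′ (λ _ → 0ℤ) ≡ 𝟘
    f′-0 = x≡x⊕x⇒x≡𝟘 G (f′ (λ _ → 0ℤ)) (F.additive (λ _ → 0ℤ) (λ _ → 0ℤ))

    f′-cong-mod : ∀ u v → u ≡ᵛ v [mod pk p k ] → f′ u ≡ f′ v
    f′-cong-mod u v u≡v = F.wd u v ((λ _ → 0ℤ) , λ i → toUnsigned (pk p k) (≡-mod-trans (u≡v i)
      (≡-mod-reflexive (sym (trans (cong (_+_ (v i)) (monicApply-0 (atP cs k) (atM X k) i))
                                   (ℤₚ.+-identityʳ (v i)))))))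

    -- p^k′ z is killed by f′, so it is equivalent to 0 in cok(P(X′)).
    approx : ∀ z → Σ (Vecℤ n) λ u → scalV (pk p k′) z ≡ᵛ P[X] k u [mod pk p k ]
    approx z = u , λ i → ≡-mod-trans (fromUnsigned (proj₂ pᵏ′z~0 i))
                                     (≡-mod-reflexive (ℤₚ.+-identityˡ (P[X] k u i)))
      where
        pᵏ′z~0 : CokRelMod p k cs X (scalV (pk p k′) z) (λ _ → 0ℤ)
        pᵏ′z~0 = F.injective (scalV (pk p k′) z) (λ _ → 0ℤ)
                   (trans (F.scalar (pk p k′) z) (trans (ann (f′ z)) (sym f′-0)))
        u : Vecℤ n
        u = proj₁ pᵏ′z~0

    open Lifting k′ approx using (pk′-multiples-in-image)

    f : VecZp n → Carrier
    f z = f′ (atV z k)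

    -- v − (w + P(X) u₀) is p^k e = p^k′ (p e), and p^k′ ℤ_p^n lies in the image of P(X).
    lift-relation : ∀ v w u₀ → CohVec p v → CohVec p w →
                    atV v k ≡ᵛ addV (atV w k) (P[X] k u₀) [mod pk p k ] → CokRelZp p cs X v w
    lift-relation v w u₀ cv cw vₖ≡wₖ+Pu₀ = U , U-coherent , λ j i → toUnsigned (pk p j) (v≡w+PU j i)
      where
        y : VecZp n
        y i = w i +ₚ P[X]ₚ u₀ i
        y-coherent : CohVec p y
        y-coherent i = +ₚ-coherent (w i) (P[X]ₚ u₀ i) (cw i) (P[X]ₚ-coherent u₀ i)
        difference : ∀ i → v i ≡ₚ y i [mod p ^ k ]
        difference i = ≡-at-level⇒≡ₚ k (v i) (y i) (cv i) (y-coherent i) (vₖ≡wₖ+Pu₀ i)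
        pe : VecZp n
        pe i = ι (+ p) *ₚ proj₁ (difference i)
        pe-coherent : CohVec p pe
        pe-coherent i =
          *ₚ-coherent (ι (+ p)) (proj₁ (difference i)) (ι-coherent (+ p)) (proj₁ (proj₂ (difference i)))
        preimage : InImage (λ i j → pk p k′ * pe i j)
        preimage = pk′-multiples-in-image pe pe-coherent
        U′ : VecZp n
        U′ = proj₁ preimage
        U : VecZp n
        U i j = U′ i j + u₀ i
        U-coherent : CohVec p U
        U-coherent i = +ₚ-coherent (U′ i) (ι (u₀ i)) (proj₁ (proj₂ preimage) i) (ι-coherent (u₀ i))
        v≡w+PU : ∀ j → atV v j ≡ᵛ addV (atV w j) (P[X] j (atV U j)) [mod pk p j ]
        v≡w+PU j i = begin
          v i j
            ≈⟨ proj₂ (proj₂ (difference i)) j ⟩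
          (w i j + P[X] j u₀ i) + pk p k * e
            ≡⟨ cong (_+_ (w i j + P[X] j u₀ i)) pᵏe≡pᵏ′pe ⟩
          (w i j + P[X] j u₀ i) + pk p k′ * (+ p * e)
            ≈⟨ +-congˡ-mod (w i j + P[X] j u₀ i) (proj₂ (proj₂ preimage) j i) ⟩
          (w i j + P[X] j u₀ i) + P[X] j (atV U′ j) i
            ≡⟨ regroup (w i j) (P[X] j u₀ i) (P[X] j (atV U′ j) i) ⟩
          w i j + (P[X] j (atV U′ j) i + P[X] j u₀ i)
            ≡⟨ cong (_+_ (w i j)) (monicApply-+ (atP cs j) (atM X j) (atV U′ j) u₀ i) ⟨
          w i j + P[X] j (atV U j) i ∎
          where
            open SetoidReasoning (≡-mod-setoid (pk p j))
            e : ℤ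
            e = proj₁ (difference i) j
            pᵏe≡pᵏ′pe : pk p k * e ≡ pk p k′ * (+ p * e)
            pᵏe≡pᵏ′pe = trans (cong (_* e) (pk-suc p k′)) (identity (+ p) (pk p k′) e)
              where identity : ∀ a b c → (a * b) * c ≡ b * (a * c)
                    identity = solve-∀
            regroup : ∀ a b c → (a + b) + c ≡ a + (c + b)
            regroup = solve-∀

    f-injective : ∀ v w → CohVec p v → CohVec p w → f v ≡ f w → CokRelZp p cs X v w
    f-injective v w cv cw fv≡fw = lift-relation v w (proj₁ vₖ~wₖ) cv cw (λ i → fromUnsigned (proj₂ vₖ~wₖ i))
      where
        vₖ~wₖ : CokRelMod p k cs X (atV v k) (atV w k)
        vₖ~wₖ = F.injective (atV v k) (atV w k) fv≡fw

    f-at-level : ∀ u v → VecEqMod (pk p k) (atV u k) v → f u ≡ f′ v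
    f-at-level u v uₖ≡v = f′-cong-mod (atV u k) v (λ i → fromUnsigned (uₖ≡v i))

    f-iso : IsCokIsoZp G X f
    f-iso = record
      { wd = λ v w _ _ (u , _ , v≡w+Pu) → F.wd (atV v k) (atV w k) (atV u k , v≡w+Pu k)
      ; additive = λ v w u _ _ _ u≈v+w →
          trans (f-at-level u (addV (atV v k) (atV w k)) (u≈v+w k)) (F.additive (atV v k) (atV w k))
      ; scalar = λ a v u ca _ _ u≈av →
          trans (f-at-level u (scalV (a k) (atV v k)) (u≈av k))
                (trans (F.scalar (a k) (atV v k)) (sym (·-reduce G k (annihilatedBy-suc G k′ ann) a ca (f′ (atV v k)))))
      ; t-equiv = λ v u _ _ u≡Xv → trans (f-at-level u (X· k (atV v k)) (u≡Xv k)) (F.t-equiv (atV v k))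
      ; injective = f-injective
      ; surjective = λ g → let (v , f′v≡g) = F.surjective g in const v , const-coherent v , f′v≡g
      }

  cokIsoZp⇒cokIsoMod : ∀ k → AnnihilatedBy G k → CokIsoZp G X → CokIsoMod G k X
  cokIsoZp⇒cokIsoMod k ann (f , iso) = ZpToMod.f′ k ann f iso , ZpToMod.f′-iso k ann f iso

  cokIsoMod⇒cokIsoZp : ∀ k′ → AnnihilatedBy G k′ → CokIsoMod G (suc k′) X → CokIsoZp G X
  cokIsoMod⇒cokIsoZp k′ ann (f′ , iso) = ModToZp.f k′ ann f′ iso , ModToZp.f-iso k′ ann f′ iso

lemma3p1 : (p : ℕ) → Prime p → (cs : List RawZp) → All (Coherent p) cs →
           (G : FinModule p cs) → (k : ℕ) → 1 ≤ k → AnnihilatedBy G (k ∸ 1) →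
           (n : ℕ) → (X : MatZp n) → CohMat p X →
           (CokIsoZp G X → CokIsoMod G k X) × (CokIsoMod G k X → CokIsoZp G X)
lemma3p1 p p-prime cs cs-coherent G zero () ann n X X-coherent
lemma3p1 p p-prime cs cs-coherent G (suc k′) _ ann n X X-coherent =
  cokIsoZp⇒cokIsoMod cs-coherent G X X-coherent (suc k′) (annihilatedBy-suc G k′ ann) ,
  cokIsoMod⇒cokIsoZp cs-coherent G X X-coherent k′ ann
  where instance
          p≢0 : ℕ.NonZero p
          p≢0 = prime⇒nonZero p-prime
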